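{- Let $G$ be a sudoku solution grid and let $U_1,\dots,U_t\subseteq G$ be pairwise disjoint unavoidable sets of degrees $k_1,\dots,k_t$ respectively. Then $U_1\cup\cdots\cup U_t$ is an unavoidable set of degree $k_1+\cdots+k_t$.
   Context: A sudoku solution grid is regarded as a function $\{0,\dots,80\}\to\{1,\dots,9\}$ satisfying the sudoku rules (each row, column and $3\times3$ box contains each digit exactly once), identified with its graph, a subset of $\{0,\dots,80\}\times\{1,\dots,9\}$. A completion of $X\subseteq G$ is a solution grid containing $X$. A subset $X\subseteq G$ is unavoidable (= unavoidable of degree 1) if $G\setminus X$ has more than one completion. Recursively, a nonempty subset $U\subseteq G$ is an unavoidable set of degree $k>1$ if for every $c\in U$ the set $U\setminus\{c\}$ is an unavoidable set of degree $k-1$. -}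

module Defs where

open import Data.Nat using (ℕ; zero; suc; _/_; _%_; _*_; _+_)
open import Data.Fin using (Fin; toℕ)
open import Data.Fin.Subset using (Subset; _∈_; _∉_; _-_; Nonempty)
open import Data.Product using (Σ; ∃; _×_)
open import Data.Empty using (⊥)
open import Relation.Binary.PropositionalEquality using (_≡_; _≢_)

-- Cells are 0..80 (row-major), digits 1..9 are encoded as Fin 9 (digit d+1 ↦ d).
Cell : Set
Cell = Fin 81

Digit : Set
Digit = Fin 9

Filling : Set
Filling = Cell → Digit

row col box : Cell → ℕ
row c = toℕ c / 9
col c = toℕ c % 9
box c = (row c / 3) * 3 + col c / 3

EachDigitOnce : (Cell → ℕ) → Filling → Set
EachDigitOnce unit G =
  (∀ (c : Cell) (d : Digit) → ∃ λ c' → unit c' ≡ unit c × G c' ≡ d)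
  × (∀ (c c' : Cell) → unit c ≡ unit c' → G c ≡ G c' → c ≡ c')

IsSolutionGrid : Filling → Set
IsSolutionGrid G = EachDigitOnce row G × EachDigitOnce col G × EachDigitOnce box G

-- A subset X of (the graph of) G is represented by its set of cells:
-- X = { (c , G c) | c ∈ S }.  Under this encoding, G \ X corresponds to the
-- complementary set of cells.

CompletionOfComplement : Filling → Subset 81 → Filling → Set
CompletionOfComplement G S H = IsSolutionGrid H × (∀ c → c ∉ S → H c ≡ G c)

-- X ⊆ G is unavoidable (degree 1): G \ X has more than one completion,
-- i.e. two completions that differ (as graphs, i.e. at some cell).
Unavoidable : Filling → Subset 81 → Set
Unavoidable G S = Σ Filling λ H₁ → Σ Filling λ H₂ →
  CompletionOfComplement G S H₁ × CompletionOfComplement G S H₂ ×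
  (∃ λ c → H₁ c ≢ H₂ c)

-- Unavoidable set of degree k (only meaningful for k ≥ 1; degree 0 is not defined,
-- encoded as ⊥).
UnavoidableOfDegree : Filling → ℕ → Subset 81 → Set
UnavoidableOfDegree G zero S = ⊥
UnavoidableOfDegree G (suc zero) S = Unavoidable G S
UnavoidableOfDegree G (suc (suc k)) S =
  Nonempty S × (∀ c → c ∈ S → UnavoidableOfDegree G (suc k) (S - c))

Disjoint : Subset 81 → Subset 81 → Set
Disjoint S T = ∀ c → c ∈ S → c ∉ T

module Submission where

-- Nothing about sudoku is used beyond the shape of the definitions: an
-- unavoidable set of degree 1 stays unavoidable when enlarged (a pair of
-- distinct completions of G \ S is also one for G \ T when S ⊆ T), and the
-- recursive definition of higher degree propagates this.  Removing a cell c of U ∪ V leaves (U - c) ∪ V (or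
--     symmetrically U ∪ (V - c)), which by induction has degree a + b - 1;
--     if U - c has no degree left (a = 1), V alone suffices, by monotonicity;
--   * the finite case, by induction on the number of sets.
-- The main theorem is the finite case.

open import Defs
open import Data.Nat using (ℕ; suc; _≤_)
open import Data.Fin using (Fin)
open import Data.Fin.Subset using (Subset; ⋃)
open import Data.List using (tabulate)
open import Data.Nat.ListAction using (sum)
open import Relation.Binary.PropositionalEquality using (_≢_)

open import Data.Nat using (zero; _+_)
open import Data.Nat.Properties using (+-suc; +-comm; +-identityʳ)
open import Data.Fin using (zero; suc)
open import Data.Fin.Properties using (suc-injective)
open import Data.Fin.Subset using (_∈_; _∉_; _─_; _-_; _∪_; _⊆_; Nonempty; ⁅_⁆)
open import Data.Fin.Subset.Properties
  using (_∈?_; ∉⊥; x∈⁅x⁆; p⊆p∪q; q⊆p∪q; x∈p∪q⁻; ⊆-trans; p─q⊆p; x∈p∧x≢y⇒x∈p-y; ∪-comm)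
open import Data.Vec using (_∷_; here; there)
open import Data.Bool using () renaming (true to inside)
open import Data.Product using (_,_; proj₁; proj₂)
open import Data.Sum using (inj₁; inj₂; [_,_]′)
open import Data.Empty using (⊥-elim)
open import Relation.Nullary using (yes; no)
open import Relation.Binary.PropositionalEquality using (_≡_; refl; sym; trans; subst; subst₂)

private
  variable
    n : ℕ
    G : Filling
    S T U V : Subset 81

x∈p─q⇒x∉q : ∀ (p q : Subset n) {x : Fin n} → x ∈ p ─ q → x ∉ q
x∈p─q⇒x∉q (_ ∷ p) (inside ∷ q) () here
x∈p─q⇒x∉q (_ ∷ p) (_ ∷ q) (there x∈p─q) (there x∈q) = x∈p─q⇒x∉q p q x∈p─q x∈q

x∉p-x : ∀ (p : Subset n) (x : Fin n) → x ∉ p - x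
x∉p-x p x x∈p-x = x∈p─q⇒x∉q p ⁅ x ⁆ x∈p-x (x∈⁅x⁆ x)

⊆-remove-absent : ∀ {S T : Subset n} {c : Fin n} → S ⊆ T → c ∉ S → S ⊆ T - c
⊆-remove-absent S⊆T c∉S y∈S = x∈p∧x≢y⇒x∈p-y (S⊆T y∈S) λ { refl → c∉S y∈S }

⊆-remove : ∀ {S T : Subset n} {c : Fin n} → S ⊆ T → S - c ⊆ T - c
⊆-remove {S = S} {c = c} S⊆T =
  ⊆-remove-absent (⊆-trans (p─q⊆p S ⁅ c ⁆) S⊆T) (x∉p-x S c)

remove-from-left : Disjoint U V → ∀ {c} → c ∈ U → (U - c) ∪ V ⊆ (U ∪ V) - c
remove-from-left {U} {V} U#V {c} c∈U = ⊆-remove-absent U-c∪V⊆U∪V c∉U-c∪V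
  where
  U-c∪V⊆U∪V : (U - c) ∪ V ⊆ U ∪ V
  U-c∪V⊆U∪V y∈ = [ (λ y∈U-c → p⊆p∪q V (p─q⊆p U ⁅ c ⁆ y∈U-c)) , q⊆p∪q U V ]′
                   (x∈p∪q⁻ (U - c) V y∈)
  c∉U-c∪V : c ∉ (U - c) ∪ V
  c∉U-c∪V c∈ = [ x∉p-x U c , U#V c c∈U ]′ (x∈p∪q⁻ (U - c) V c∈)

Disjoint-sym : Disjoint U V → Disjoint V U
Disjoint-sym U#V c c∈V c∈U = U#V c c∈U c∈V

∉⋃ : ∀ t (W : Fin t → Subset n) {c : Fin n} → (∀ i → c ∉ W i) → c ∉ ⋃ (tabulate W)
∉⋃ zero    W c∉W c∈⋃ = ∉⊥ c∈⋃
∉⋃ (suc t) W c∉W c∈⋃ =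
  [ c∉W zero , ∉⋃ t (λ i → W (suc i)) (λ i → c∉W (suc i)) ]′ (x∈p∪q⁻ (W zero) _ c∈⋃)

-- Degree 1 is upward closed: completions of G \ S are completions of G \ T.
unavoidable-mono : S ⊆ T → Unavoidable G S → Unavoidable G T
unavoidable-mono {S} {T} {G} S⊆T (H₁ , H₂ , (H₁-grid , H₁-agrees) , (H₂-grid , H₂-agrees) , differ) =
  H₁ , H₂ , (H₁-grid , agree H₁-agrees) , (H₂-grid , agree H₂-agrees) , differ
  where
  agree : ∀ {H : Filling} → (∀ c → c ∉ S → H c ≡ G c) → ∀ c → c ∉ T → H c ≡ G c
  agree H-agrees c c∉T = H-agrees c (λ c∈S → c∉T (S⊆T c∈S))

-- An unavoidable set is nonempty: the two completions differ inside it.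
unavoidable-nonempty : Unavoidable G S → Nonempty S
unavoidable-nonempty {S = S} (H₁ , H₂ , (_ , H₁-agrees) , (_ , H₂-agrees) , c , H₁c≢H₂c)
  with c ∈? S
... | yes c∈S = c , c∈S
... | no  c∉S = ⊥-elim (H₁c≢H₂c (trans (H₁-agrees c c∉S) (sym (H₂-agrees c c∉S))))

nonempty : ∀ k → UnavoidableOfDegree G (suc k) S → Nonempty S
nonempty zero    u        = unavoidable-nonempty u
nonempty (suc k) (ne , _) = ne

-- Degree k+2 implies degree k+1: the base case enlarges S - x back to S.
lower : ∀ k → UnavoidableOfDegree G (suc (suc k)) S → UnavoidableOfDegree G (suc k) S
lower {S = S} zero ((x , x∈S) , remove) = unavoidable-mono (p─q⊆p S ⁅ x ⁆) (remove x x∈S)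
lower (suc k) (ne , remove) = ne , λ c c∈S → lower k (remove c c∈S)

-- Degree k is upward closed.  Removing c ∈ T from T: if c ∈ S then
-- S - c ⊆ T - c; otherwise S ⊆ T - c, and S has degree k - 1 by `lower`.
mono : ∀ k → S ⊆ T → UnavoidableOfDegree G (suc k) S → UnavoidableOfDegree G (suc k) T
mono zero S⊆T u = unavoidable-mono S⊆T u
mono {S} {T} {G} (suc k) S⊆T u@((x , x∈S) , remove) = (x , S⊆T x∈S) , removeFromT
  where
  removeFromT : ∀ c → c ∈ T → UnavoidableOfDegree G (suc k) (T - c)
  removeFromT c c∈T with c ∈? S
  ... | yes c∈S = mono k (⊆-remove S⊆T) (remove c c∈S)
  ... | no  c∉S = mono k (⊆-remove-absent S⊆T c∉S) (lower k u)

mono-any : ∀ k → S ⊆ T → UnavoidableOfDegree G k S → UnavoidableOfDegree G k T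
mono-any (suc k) = mono k

mutual
  combine : ∀ a b → Disjoint U V → UnavoidableOfDegree G (suc a) U →
            UnavoidableOfDegree G (suc b) V → UnavoidableOfDegree G (suc (suc (a + b))) (U ∪ V)
  combine {U} {V} {G} a b U#V u v = (x , p⊆p∪q V x∈U) , removeCell
    where
    x = proj₁ (nonempty a u)
    x∈U = proj₂ (nonempty a u)
    removeCell : ∀ c → c ∈ U ∪ V → UnavoidableOfDegree G (suc (a + b)) ((U ∪ V) - c)
    removeCell c c∈ with x∈p∪q⁻ U V c∈
    ... | inj₁ c∈U = remove-left a b U#V u v c∈U
    ... | inj₂ c∈V = subst₂ (λ m W → UnavoidableOfDegree G (suc m) (W - c))
                       (+-comm b a) (∪-comm V U)
                       (remove-left b a (Disjoint-sym U#V) v u c∈V)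

  -- Removing a cell c ∈ U: what remains contains (U - c) ∪ V, which has
  -- degree a + b by induction when a > 0, and contains V when a = 0.
  remove-left : ∀ a b → Disjoint U V → UnavoidableOfDegree G (suc a) U →
                UnavoidableOfDegree G (suc b) V →
                ∀ {c} → c ∈ U → UnavoidableOfDegree G (suc (a + b)) ((U ∪ V) - c)
  remove-left {U} {V} zero b U#V u v c∈U =
    mono b (⊆-trans (q⊆p∪q (U - _) V) (remove-from-left U#V c∈U)) v
  remove-left {U} (suc a) b U#V (_ , remove) v {c} c∈U =
    mono (suc (a + b)) (remove-from-left U#V c∈U)
      (combine a b (λ y y∈U-c → U#V y (p─q⊆p U ⁅ c ⁆ y∈U-c)) (remove c c∈U) v)

degree-additive : ∀ a b → Disjoint U V → UnavoidableOfDegree G a U →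
                  UnavoidableOfDegree G b V → UnavoidableOfDegree G (a + b) (U ∪ V)
degree-additive {U} {V} {G} (suc a) (suc b) U#V u v =
  subst (λ m → UnavoidableOfDegree G (suc m) (U ∪ V)) (sym (+-suc a b)) (combine a b U#V u v)

degree-additive-family : ∀ t (W : Fin (suc t) → Subset 81) (k : Fin (suc t) → ℕ) →
  (∀ i j → i ≢ j → Disjoint (W i) (W j)) →
  (∀ i → UnavoidableOfDegree G (k i) (W i)) →
  UnavoidableOfDegree G (sum (tabulate k)) (⋃ (tabulate W))
degree-additive-family {G} zero W k _ w =
  subst (λ m → UnavoidableOfDegree G m (⋃ (tabulate W))) (sym (+-identityʳ (k zero)))
    (mono-any (k zero) (p⊆p∪q _) (w zero))
degree-additive-family (suc t) W k W# w =
  degree-additive (k zero) _ first#rest (w zero)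
    (degree-additive-family t (λ i → W (suc i)) (λ i → k (suc i))
      (λ i j i≢j → W# (suc i) (suc j) (λ e → i≢j (suc-injective e)))
      (λ i → w (suc i)))
  where
  first#rest : Disjoint (W zero) (⋃ (tabulate (λ i → W (suc i))))
  first#rest c c∈W₀ = ∉⋃ (suc t) (λ i → W (suc i)) (λ i → W# zero (suc i) (λ ()) c c∈W₀)

mainTheorem9 : (G : Filling) → IsSolutionGrid G →
    (t : ℕ) → 1 ≤ t → (U : Fin t → Subset 81) → (k : Fin t → ℕ) →
    (∀ i j → i ≢ j → Disjoint (U i) (U j)) →
    (∀ i → 1 ≤ k i) →
    (∀ i → UnavoidableOfDegree G (k i) (U i)) →
    UnavoidableOfDegree G (sum (tabulate k)) (⋃ (tabulate U))
mainTheorem9 G _ (suc t) _ U k disjoint _ unavoidable =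
  degree-additive-family t U k disjoint unavoidable
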